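{- Let $n,\ell$ be positive integers and $\bar T_1,\bar T_2$ 2-factor types. For $i=1,\ldots,\ell$, let $\mu_i$ be a positive integer and assume $HWP(\mu_iK_n;\bar T_1,\bar T_2;\alpha_i,\gamma_i)$ has a solution. Let $\mathcal{O}=\{i:\mu_i(n-1)\text{ is odd}\}$, let $\lambda$ be a positive integer, take any $(x_1,\ldots,x_\ell)\in\mathbb{N}^\ell$ with $\sum_{i=1}^\ell x_i\mu_i=\lambda$, and let $\beta=\sum_{i\in\mathcal{O}}x_i$. (i) If $\beta\le 1$, then $HWP(\lambda K_n;\bar T_1,\bar T_2;\sum_i x_i\alpha_i,\sum_i x_i\gamma_i)$ has a solution. (ii) If $\bar T_1$ is bipartite, then $HWP(\lambda K_n;\bar T_1,\bar T_2;\sum_i x_i\alpha_i+\bar\alpha,\sum_ix_i\gamma_i+\bar\gamma)$ has a solution for all nonnegative integers $\bar\alpha,\bar\gamma$ such that (a) $\bar\alpha+\bar\gamma=\lfloor\beta/2\rfloor$ and (b) $\bar\gamma=0$ if $\bar T_2$ is not bipartite.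
   Context: $\mu K_n$: complete multigraph on $n$ vertices with $\mu$ parallel edges per pair. A 2-factor has type $[c_1,\ldots,c_t]$ if it is a disjoint union of cycles of lengths $c_1,\ldots,c_t$ (2-cycles allowed in multigraphs); a type is bipartite if all lengths are even. A 2-factorization of an $r$-regular graph is a decomposition into $\lfloor r/2\rfloor$ 2-factors plus a single 1-factor if $r$ is odd. For an $r$-regular graph $\mathcal{G}$, 2-factor types $T_1,T_2$ and nonnegative integers $\alpha_1,\alpha_2$ with $\alpha_1+\alpha_2=\lfloor r/2\rfloor$, $HWP(\mathcal{G};T_1,T_2;\alpha_1,\alpha_2)$ (Hamilton–Waterloo Problem) asks whether $\mathcal{G}$ admits a 2-factorization with exactly $\alpha_1$ 2-factors of type $T_1$ and $\alpha_2$ of type $T_2$; it has a solution if such exists. -}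

module Defs where

open import Data.Nat using (ℕ; zero; suc; _+_; _*_; _∸_; _≤_; _/_; _%_)
open import Data.Fin using (Fin)
open import Data.Fin.Properties using () renaming (_≟_ to _≟F_)
open import Data.List using (List; []; _∷_; length; map; concat; concatMap; filter; allFin; _++_)
open import Data.Nat.ListAction using (sum)
open import Data.List.Relation.Unary.All using (All)
open import Data.List.Relation.Binary.Permutation.Propositional using (_↭_)
open import Data.Product using (_×_; _,_; proj₁; proj₂)
open import Data.Bool using (if_then_else_)
open import Relation.Nullary using (does)
open import Relation.Nullary.Decidable using (_×-dec_; _⊎-dec_)
open import Relation.Binary.PropositionalEquality using (_≡_)
import Data.Empty
import Data.Nat as N

-- Sum of f i over i ∈ {0, …, ℓ-1}  (i.e. Σ_{i=1}^{ℓ} in the paper's indexing)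
Σ[_] : ∀ {ℓ} → (Fin ℓ → ℕ) → ℕ
Σ[_] {ℓ} f = sum (map f (allFin ℓ))

-- A 2-factor type is bipartite if all its cycle lengths are even.
Even : ℕ → Set
Even m = m % 2 ≡ 0

Bipartite : List ℕ → Set
Bipartite T = All Even T

-- A 2-factor type for n vertices: cycle lengths ≥ 2 (2-cycles allowed) summing to n.
IsTwoFactorType : ℕ → List ℕ → Set
IsTwoFactorType n T = All (2 ≤_) T × (sum T ≡ n)

-- The (multi)edges of the closed walk v0 v1 … v(k-1) v0, as ordered pairs.
-- For a 2-cycle [a , b] this gives two parallel edges (a,b), (b,a).
cycEdges : ∀ {A : Set} → List A → List (A × A)
cycEdges {A} [] = []
cycEdges {A} (v ∷ vs) = go (v ∷ vs)
  where
  go : List A → List (A × A)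
  go [] = []
  go (a ∷ []) = (a , v) ∷ []
  go (a ∷ b ∷ r) = (a , b) ∷ go (b ∷ r)

edgeMult : ∀ {n} → Fin n → Fin n → List (Fin n × Fin n) → ℕ
edgeMult u v es =
  length (filter (λ e → ((proj₁ e ≟F u) ×-dec (proj₂ e ≟F v)) ⊎-dec ((proj₁ e ≟F v) ×-dec (proj₂ e ≟F u))) es)

record TwoFactor (n : ℕ) : Set where
  field
    cycles   : List (List (Fin n))
    cycLen   : All (λ c → 2 ≤ length c) cycles
    spanning : concat cycles ↭ allFin n

  edges : List (Fin n × Fin n)
  edges = concatMap cycEdges cycles

  HasType : List ℕ → Set
  HasType T = map length cycles ↭ T

record OneFactor (n : ℕ) : Set where
  field
    pairs    : List (Fin n × Fin n)
    spanning : concatMap (λ p → proj₁ p ∷ proj₂ p ∷ []) pairs ↭ allFin n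

-- A solution of HWP(λ K_n ; T1 , T2 ; a1 , a2): a 2-factorization of the
-- r-regular multigraph λK_n (r = λ(n-1)) into a1 2-factors of type T1,
-- a2 2-factors of type T2, plus a single 1-factor iff r is odd, such that
-- together they use every pair {u,v} (u ≠ v) exactly λ times.
record HWP (n λ' : ℕ) (T1 T2 : List ℕ) (a1 a2 : ℕ) : Set where
  field
    countOK : a1 + a2 ≡ (λ' * (n ∸ 1)) / 2
    fs1     : List (TwoFactor n)
    len1    : length fs1 ≡ a1
    type1   : All (λ F → TwoFactor.HasType F T1) fs1
    fs2     : List (TwoFactor n)
    len2    : length fs2 ≡ a2
    type2   : All (λ F → TwoFactor.HasType F T2) fs2
    ones    : List (OneFactor n)
    lenOnes : length ones ≡ (λ' * (n ∸ 1)) % 2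
    decomp  : ∀ (u v : Fin n) → (u ≡ v → Data.Empty.⊥) →
              edgeMult u v (concatMap TwoFactor.edges fs1 ++ concatMap TwoFactor.edges fs2
                            ++ concatMap OneFactor.pairs ones) ≡ λ'

-- β = Σ_{i ∈ O} x_i where O = { i : μ_i (n-1) odd }
betaSum : ∀ {ℓ} → ℕ → (Fin ℓ → ℕ) → (Fin ℓ → ℕ) → ℕ
betaSum n μ x = Σ[ (λ i → if does (((μ i * (n ∸ 1)) % 2) N.≟ 1) then x i else 0) ]

module Submission where

-- Write D_i for the given solution of
-- HWP(μ_i K_n; T1, T2; α_i, γ_i); it has exactly one 1-factor when μ_i(n-1) is
-- odd and none otherwise.  Taking x_i copies of every D_i and uniting them
-- decomposes (Σ x_i μ_i) K_n = λK_n, with β leftover 1-factors.  Two leftover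
-- 1-factors O, O' can be traded for one 2-factor of any bipartite type T: run
-- through O a 2-factor F of type T (chunks of O closed into even cycles), whose
-- other edges form a perfect matching H, and relabel the vertices of the
-- solution containing O' so that O' becomes H.  Merging ⌊β/2⌋ pairs gives (ii);
-- merging none gives (i).

open import Defs
open import Data.Nat using (ℕ; zero; suc; _+_; _*_; _∸_; _≤_; _<_; _/_; _%_; z≤n; s≤s; _≟_)
open import Data.Nat.Properties
open import Data.Nat.DivMod
  using (m≡m%n+[m/n]*n; m%n<n; m<n⇒m%n≡m; m<n⇒m/n≡0; m*n/n≡m; +-distrib-/; [m+kn]%n≡m%n; m*n%n≡0)
open import Data.Nat.ListAction using (sum)
open import Data.Nat.ListAction.Properties using (sum-++; sum-↭)
open import Data.Nat.Solver using (module +-*-Solver)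
open import Data.Bool using (if_then_else_)
open import Data.Fin using (Fin)
open import Data.Fin.Properties using () renaming (_≟_ to _≟F_)
open import Data.List using (List; []; _∷_; _++_; length; map; concat; concatMap; filter; allFin; replicate; take; drop)
open import Data.List.Properties
  using (length-++; filter-++; map-++; concat-map; concatMap-++; concatMap-map; map-concatMap; concatMap-cong;
         map-cong; map-cong-local; map-∘; map-id; length-map; length-tabulate; ++-identityʳ; length-take;
         length-drop; take++drop≡id; ∷-injective)
open import Data.List.Relation.Unary.All using (All; []; _∷_; all?)
import Data.List.Relation.Unary.All as All
import Data.List.Relation.Unary.All.Properties as AllP
open import Data.List.Relation.Unary.Any using (here; there)
open import Data.List.Membership.Propositional using (_∈_)
open import Data.List.Membership.Propositional.Properties using (∈-allFin)
open import Data.List.Relation.Unary.Unique.Propositional using (Unique)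
open import Data.List.Relation.Unary.Unique.Propositional.Properties using (allFin⁺)
open import Data.List.Relation.Unary.AllPairs using (_∷_)
open import Data.List.Relation.Binary.Permutation.Propositional
  using (_↭_; ↭-refl; ↭-sym; ↭-trans; ↭-reflexive; prep; swap; ↭⇒↭ₛ; module PermutationReasoning)
open import Data.List.Relation.Binary.Permutation.Propositional.Properties
  using (filter-↭; ↭-length; map⁺; ++⁺; ++⁺ˡ; ++-comm; ++-assoc; shift; shifts; ∈-resp-↭)
import Data.List.Relation.Binary.Permutation.Setoid.Properties as PermSetoid
open import Data.Product using (Σ; _×_; _,_; proj₁; proj₂; map₂)
open import Data.Sum using (_⊎_; inj₁; inj₂)
import Data.Sum as Sum
open import Data.Empty using (⊥-elim)
open import Level using (Level)
open import Function using (_∘_; _⇔_; mk⇔; Equivalence)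
open import Relation.Nullary using (¬_; yes; no; does)
open import Relation.Nullary.Decidable using (_×-dec_; _⊎-dec_)
open import Relation.Unary using (Pred; Decidable)
open import Relation.Binary.PropositionalEquality
  using (_≡_; _≢_; refl; sym; trans; cong; cong₂; subst; setoid; module ≡-Reasoning)

open +-*-Solver using (solve; _:+_; _:*_; _:=_; con)

private
  variable
    n : ℕ

Joins : Fin n → Fin n → Fin n × Fin n → Set
Joins u v e = (proj₁ e ≡ u × proj₂ e ≡ v) ⊎ (proj₁ e ≡ v × proj₂ e ≡ u)

joins? : (u v : Fin n) → Decidable (Joins u v)
joins? u v e = ((proj₁ e ≟F u) ×-dec (proj₂ e ≟F v)) ⊎-dec ((proj₁ e ≟F v) ×-dec (proj₂ e ≟F u))

length-filter-map : ∀ {A B : Set} {p q : Level} {P : Pred B p} {Q : Pred A q} (P? : Decidable P) (Q? : Decidable Q)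
                    (f : A → B) → (∀ x → P (f x) ⇔ Q x) →
                    ∀ xs → length (filter P? (map f xs)) ≡ length (filter Q? xs)
length-filter-map P? Q? f P⇔Q [] = refl
length-filter-map P? Q? f P⇔Q (x ∷ xs) with P? (f x) | Q? x
... | yes _  | yes _  = cong suc (length-filter-map P? Q? f P⇔Q xs)
... | no  _  | no  _  = length-filter-map P? Q? f P⇔Q xs
... | yes p  | no ¬q  = ⊥-elim (¬q (Equivalence.to (P⇔Q x) p))
... | no ¬p  | yes q  = ⊥-elim (¬p (Equivalence.from (P⇔Q x) q))

edgeMult-++ : (u v : Fin n) (xs ys : List (Fin n × Fin n)) →
              edgeMult u v (xs ++ ys) ≡ edgeMult u v xs + edgeMult u v ys
edgeMult-++ u v xs ys = trans (cong length (filter-++ (joins? u v) xs ys)) (length-++ (filter (joins? u v) xs))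

edgeMult-↭ : (u v : Fin n) {xs ys : List (Fin n × Fin n)} → xs ↭ ys → edgeMult u v xs ≡ edgeMult u v ys
edgeMult-↭ u v xs↭ys = ↭-length (filter-↭ (joins? u v) xs↭ys)

mapEdge : ∀ {A B : Set} → (A → B) → A × A → B × B
mapEdge f e = f (proj₁ e) , f (proj₂ e)

-- The edges of the walk a₀ a₁ … a_k followed by the closing edge a_k z.
-- For z = a₀ this is the edge list of the cycle a₀ … a_k.
closingPath : ∀ {A : Set} → A → List A → List (A × A)
closingPath z []          = []
closingPath z (a ∷ [])    = (a , z) ∷ []
closingPath z (a ∷ b ∷ r) = (a , b) ∷ closingPath z (b ∷ r)

cycEdges≡closingPath : ∀ {A : Set} (a : A) r → cycEdges (a ∷ r) ≡ closingPath a (a ∷ r)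
cycEdges≡closingPath a []      = refl
cycEdges≡closingPath a (b ∷ r) = cong ((a , b) ∷_) (tail-cycEdges b r)
  where
  tail-cycEdges : ∀ b r → drop 1 (cycEdges (a ∷ b ∷ r)) ≡ closingPath a (b ∷ r)
  tail-cycEdges b []      = refl
  tail-cycEdges b (c ∷ r) = cong ((b , c) ∷_) (tail-cycEdges c r)

closingPath-map : ∀ {A B : Set} (f : A → B) z l → closingPath (f z) (map f l) ≡ map (mapEdge f) (closingPath z l)
closingPath-map f z []          = refl
closingPath-map f z (a ∷ [])    = refl
closingPath-map f z (a ∷ b ∷ l) = cong ((f a , f b) ∷_) (closingPath-map f z (b ∷ l))

cycEdges-map : ∀ {A B : Set} (f : A → B) c → cycEdges (map f c) ≡ map (mapEdge f) (cycEdges c)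
cycEdges-map f []      = refl
cycEdges-map f (a ∷ r) = begin
  cycEdges (f a ∷ map f r)                  ≡⟨ cycEdges≡closingPath (f a) (map f r) ⟩
  closingPath (f a) (f a ∷ map f r)         ≡⟨ closingPath-map f a (a ∷ r) ⟩
  map (mapEdge f) (closingPath a (a ∷ r))   ≡⟨ cong (map (mapEdge f)) (cycEdges≡closingPath a r) ⟨
  map (mapEdge f) (cycEdges (a ∷ r))        ∎
  where open ≡-Reasoning

edges₂ : List (TwoFactor n) → List (Fin n × Fin n)
edges₂ = concatMap TwoFactor.edges

edges₁ : List (OneFactor n) → List (Fin n × Fin n)
edges₁ = concatMap OneFactor.pairs

endpoints : List (Fin n × Fin n) → List (Fin n)
endpoints = concatMap (λ p → proj₁ p ∷ proj₂ p ∷ [])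

allEdges : List (TwoFactor n) → List (TwoFactor n) → List (OneFactor n) → List (Fin n × Fin n)
allEdges Fs Gs Os = edges₂ Fs ++ edges₂ Gs ++ edges₁ Os

edgeMult-allEdges : (u v : Fin n) (Fs Gs : List (TwoFactor n)) (Os : List (OneFactor n)) →
                    edgeMult u v (allEdges Fs Gs Os)
                      ≡ edgeMult u v (edges₂ Fs) + edgeMult u v (edges₂ Gs) + edgeMult u v (edges₁ Os)
edgeMult-allEdges u v Fs Gs Os = begin
  edgeMult u v (edges₂ Fs ++ edges₂ Gs ++ edges₁ Os)
    ≡⟨ edgeMult-++ u v (edges₂ Fs) _ ⟩
  edgeMult u v (edges₂ Fs) + edgeMult u v (edges₂ Gs ++ edges₁ Os)
    ≡⟨ cong (edgeMult u v (edges₂ Fs) +_) (edgeMult-++ u v (edges₂ Gs) _) ⟩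
  edgeMult u v (edges₂ Fs) + (edgeMult u v (edges₂ Gs) + edgeMult u v (edges₁ Os))
    ≡⟨ +-assoc (edgeMult u v (edges₂ Fs)) _ _ ⟨
  edgeMult u v (edges₂ Fs) + edgeMult u v (edges₂ Gs) + edgeMult u v (edges₁ Os) ∎
  where open ≡-Reasoning

edgeMult-allEdges-++ : (u v : Fin n) (Fs Fs′ Gs Gs′ : List (TwoFactor n)) (Os Os′ : List (OneFactor n)) →
                       edgeMult u v (allEdges (Fs ++ Fs′) (Gs ++ Gs′) (Os ++ Os′))
                         ≡ edgeMult u v (allEdges Fs Gs Os) + edgeMult u v (allEdges Fs′ Gs′ Os′)
edgeMult-allEdges-++ {n} u v Fs Fs′ Gs Gs′ Os Os′ = begin
  edgeMult u v (allEdges (Fs ++ Fs′) (Gs ++ Gs′) (Os ++ Os′))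
    ≡⟨ edgeMult-allEdges u v (Fs ++ Fs′) (Gs ++ Gs′) (Os ++ Os′) ⟩
  m₂ (Fs ++ Fs′) + m₂ (Gs ++ Gs′) + m₁ (Os ++ Os′)
    ≡⟨ cong₂ _+_ (cong₂ _+_ (m₂-++ Fs Fs′) (m₂-++ Gs Gs′)) (m₁-++ Os Os′) ⟩
  (m₂ Fs + m₂ Fs′) + (m₂ Gs + m₂ Gs′) + (m₁ Os + m₁ Os′)
    ≡⟨ solve 6 (λ f g o f′ g′ o′ → (f :+ f′) :+ (g :+ g′) :+ (o :+ o′) := (f :+ g :+ o) :+ (f′ :+ g′ :+ o′))
               refl (m₂ Fs) (m₂ Gs) (m₁ Os) (m₂ Fs′) (m₂ Gs′) (m₁ Os′) ⟩
  (m₂ Fs + m₂ Gs + m₁ Os) + (m₂ Fs′ + m₂ Gs′ + m₁ Os′)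
    ≡⟨ cong₂ _+_ (edgeMult-allEdges u v Fs Gs Os) (edgeMult-allEdges u v Fs′ Gs′ Os′) ⟨
  edgeMult u v (allEdges Fs Gs Os) + edgeMult u v (allEdges Fs′ Gs′ Os′) ∎
  where
  open ≡-Reasoning
  m₂ : List (TwoFactor n) → ℕ
  m₂ Fs = edgeMult u v (edges₂ Fs)
  m₁ : List (OneFactor n) → ℕ
  m₁ Os = edgeMult u v (edges₁ Os)
  m₂-++ : ∀ Fs Gs → m₂ (Fs ++ Gs) ≡ m₂ Fs + m₂ Gs
  m₂-++ Fs Gs = trans (cong (edgeMult u v) (concatMap-++ TwoFactor.edges Fs Gs)) (edgeMult-++ u v (edges₂ Fs) _)
  m₁-++ : ∀ Os Ps → m₁ (Os ++ Ps) ≡ m₁ Os + m₁ Ps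
  m₁-++ Os Ps = trans (cong (edgeMult u v) (concatMap-++ OneFactor.pairs Os Ps)) (edgeMult-++ u v (edges₁ Os) _)

edgeMult-absorb : (u v : Fin n) (F : TwoFactor n) (Fs Gs : List (TwoFactor n)) (Os : List (OneFactor n)) →
                  TwoFactor.edges F ↭ edges₁ Os → edgeMult u v (allEdges (F ∷ Fs) Gs []) ≡ edgeMult u v (allEdges Fs Gs Os)
edgeMult-absorb {n} u v F Fs Gs Os F-edges = begin
  m (allEdges (F ∷ Fs) Gs [])
    ≡⟨ edgeMult-allEdges u v (F ∷ Fs) Gs [] ⟩
  m (TwoFactor.edges F ++ edges₂ Fs) + m (edges₂ Gs) + 0
    ≡⟨ cong (λ k → k + m (edges₂ Gs) + 0) (edgeMult-++ u v (TwoFactor.edges F) _) ⟩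
  m (TwoFactor.edges F) + m (edges₂ Fs) + m (edges₂ Gs) + 0
    ≡⟨ cong (λ k → k + m (edges₂ Fs) + m (edges₂ Gs) + 0) (edgeMult-↭ u v F-edges) ⟩
  m (edges₁ Os) + m (edges₂ Fs) + m (edges₂ Gs) + 0
    ≡⟨ solve 3 (λ o f g → o :+ f :+ g :+ con 0 := f :+ g :+ o) refl (m (edges₁ Os)) (m (edges₂ Fs)) (m (edges₂ Gs)) ⟩
  m (edges₂ Fs) + m (edges₂ Gs) + m (edges₁ Os)
    ≡⟨ edgeMult-allEdges u v Fs Gs Os ⟨
  m (allEdges Fs Gs Os) ∎
  where
  open ≡-Reasoning
  m : List (Fin n × Fin n) → ℕ
  m = edgeMult u v

record Relabelling (n : ℕ) : Set where
  field
    to       : Fin n → Fin n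
    from     : Fin n → Fin n
    from-to  : ∀ a → from (to a) ≡ a
    to-from  : ∀ a → to (from a) ≡ a
    permutes : map to (allFin n) ↭ allFin n

  to-injective : ∀ {a b} → to a ≡ to b → a ≡ b
  to-injective {a} {b} eq = trans (sym (from-to a)) (trans (cong from eq) (from-to b))

  joins-mapEdge : ∀ u v e → Joins (to u) (to v) (mapEdge to e) ⇔ Joins u v e
  joins-mapEdge u v e = mk⇔ (Sum.map both-injective both-injective) (Sum.map both-cong both-cong)
    where
    both-injective : ∀ {a b c d} → to a ≡ to c × to b ≡ to d → a ≡ c × b ≡ d
    both-injective (p , q) = to-injective p , to-injective q
    both-cong : ∀ {a b c d} → a ≡ c × b ≡ d → to a ≡ to c × to b ≡ to d
    both-cong (p , q) = cong to p , cong to q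

  edgeMult-mapEdge : ∀ u v es → edgeMult (to u) (to v) (map (mapEdge to) es) ≡ edgeMult u v es
  edgeMult-mapEdge u v = length-filter-map (joins? (to u) (to v)) (joins? u v) (mapEdge to) (joins-mapEdge u v)

  twoFactor : TwoFactor n → TwoFactor n
  twoFactor F = record
    { cycles   = map (map to) cycles
    ; cycLen   = AllP.map⁺ (All.map (λ {c} 2≤c → subst (2 ≤_) (sym (length-map to c)) 2≤c) cycLen)
    ; spanning = ↭-trans (↭-reflexive (concat-map cycles)) (↭-trans (map⁺ to spanning) permutes)
    }
    where open TwoFactor F

  twoFactor-edges : ∀ F → TwoFactor.edges (twoFactor F) ≡ map (mapEdge to) (TwoFactor.edges F)
  twoFactor-edges F = begin
    concatMap cycEdges (map (map to) cs)       ≡⟨ concatMap-map cycEdges (map to) cs ⟩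
    concatMap (cycEdges ∘ map to) cs           ≡⟨ concatMap-cong (cycEdges-map to) cs ⟩
    concatMap (map (mapEdge to) ∘ cycEdges) cs ≡⟨ map-concatMap (mapEdge to) cycEdges cs ⟨
    map (mapEdge to) (concatMap cycEdges cs)   ∎
    where open ≡-Reasoning
          cs = TwoFactor.cycles F

  twoFactor-type : ∀ {F} T → TwoFactor.HasType F T → TwoFactor.HasType (twoFactor F) T
  twoFactor-type {F} T hasType = ↭-trans (↭-reflexive lengths) hasType
    where
    lengths : map length (map (map to) (TwoFactor.cycles F)) ≡ map length (TwoFactor.cycles F)
    lengths = trans (sym (map-∘ (TwoFactor.cycles F))) (map-cong (length-map to) (TwoFactor.cycles F))

  oneFactor : OneFactor n → OneFactor n
  oneFactor O = record
    { pairs    = map (mapEdge to) pairs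
    ; spanning = ↭-trans (↭-reflexive (endpoints-map pairs)) (↭-trans (map⁺ to spanning) permutes)
    }
    where
    open OneFactor O
    endpoints-map : ∀ ps → endpoints (map (mapEdge to) ps) ≡ map to (endpoints ps)
    endpoints-map []       = refl
    endpoints-map (p ∷ ps) = cong (λ r → to (proj₁ p) ∷ to (proj₂ p) ∷ r) (endpoints-map ps)

  edges₂-map : ∀ Fs → edges₂ (map twoFactor Fs) ≡ map (mapEdge to) (edges₂ Fs)
  edges₂-map Fs = begin
    concatMap TwoFactor.edges (map twoFactor Fs)       ≡⟨ concatMap-map TwoFactor.edges twoFactor Fs ⟩
    concatMap (TwoFactor.edges ∘ twoFactor) Fs         ≡⟨ concatMap-cong twoFactor-edges Fs ⟩
    concatMap (map (mapEdge to) ∘ TwoFactor.edges) Fs  ≡⟨ map-concatMap (mapEdge to) TwoFactor.edges Fs ⟨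
    map (mapEdge to) (edges₂ Fs)                       ∎
    where open ≡-Reasoning

  edges₁-map : ∀ Os → edges₁ (map oneFactor Os) ≡ map (mapEdge to) (edges₁ Os)
  edges₁-map Os = trans (concatMap-map OneFactor.pairs oneFactor Os)
                        (sym (map-concatMap (mapEdge to) OneFactor.pairs Os))

  allEdges-map : ∀ Fs Gs Os → allEdges (map twoFactor Fs) (map twoFactor Gs) (map oneFactor Os)
                              ≡ map (mapEdge to) (allEdges Fs Gs Os)
  allEdges-map Fs Gs Os = begin
    edges₂ (map twoFactor Fs) ++ edges₂ (map twoFactor Gs) ++ edges₁ (map oneFactor Os)
      ≡⟨ cong₂ _++_ (edges₂-map Fs) (cong₂ _++_ (edges₂-map Gs) (edges₁-map Os)) ⟩
    map (mapEdge to) (edges₂ Fs) ++ map (mapEdge to) (edges₂ Gs) ++ map (mapEdge to) (edges₁ Os)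
      ≡⟨ cong (map (mapEdge to) (edges₂ Fs) ++_) (map-++ (mapEdge to) (edges₂ Gs) _) ⟨
    map (mapEdge to) (edges₂ Fs) ++ map (mapEdge to) (edges₂ Gs ++ edges₁ Os)
      ≡⟨ map-++ (mapEdge to) (edges₂ Fs) _ ⟨
    map (mapEdge to) (allEdges Fs Gs Os) ∎
    where open ≡-Reasoning

  edgeMult-relabelled : ∀ u v es → edgeMult u v (map (mapEdge to) es) ≡ edgeMult (from u) (from v) es
  edgeMult-relabelled u v es =
    trans (cong₂ (λ a b → edgeMult a b (map (mapEdge to) es)) (sym (to-from u)) (sym (to-from v)))
          (edgeMult-mapEdge (from u) (from v) es)

  from-distinct : ∀ {u v} → u ≢ v → from u ≢ from v
  from-distinct {u} {v} u≢v eq = u≢v (trans (sym (to-from u)) (trans (cong to eq) (to-from v)))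

-- HWP solutions are exactly the decompositions with at most
-- one 1-factor; allowing more makes decompositions closed under union.
record Decomposition (n : ℕ) (T1 T2 : List ℕ) : Set where
  field
    fold      : ℕ
    factors₁  : List (TwoFactor n)
    factors₂  : List (TwoFactor n)
    matchings : List (OneFactor n)
    types₁    : All (λ F → TwoFactor.HasType F T1) factors₁
    types₂    : All (λ F → TwoFactor.HasType F T2) factors₂
    degree    : 2 * (length factors₁ + length factors₂) + length matchings ≡ fold * (n ∸ 1)
    covers    : ∀ u v → u ≢ v → edgeMult u v (allEdges factors₁ factors₂ matchings) ≡ fold

  nFactors₁ nFactors₂ nMatchings : ℕ
  nFactors₁  = length factors₁
  nFactors₂  = length factors₂
  nMatchings = length matchings

open Decomposition

module _ {T1 T2 : List ℕ} where

  fromHWP : ∀ {λ' a₁ a₂} → HWP n λ' T1 T2 a₁ a₂ → Decomposition n T1 T2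
  fromHWP {n} {λ'} H = record
    { fold = λ' ; factors₁ = fs1 ; factors₂ = fs2 ; matchings = ones ; types₁ = type1 ; types₂ = type2
    ; degree = begin
        2 * (length fs1 + length fs2) + length ones
          ≡⟨ cong₂ (λ a k → 2 * a + k) (trans (cong₂ _+_ len1 len2) countOK) lenOnes ⟩
        2 * (r / 2) + r % 2
          ≡⟨ solve 2 (λ q k → con 2 :* q :+ k := k :+ q :* con 2) refl (r / 2) (r % 2) ⟩
        r % 2 + r / 2 * 2
          ≡⟨ m≡m%n+[m/n]*n r 2 ⟨
        r ∎
    ; covers = decomp }
    where
    open HWP H
    open ≡-Reasoning
    r : ℕ
    r = λ' * (n ∸ 1)

  -- A decomposition with at most one 1-factor is an HWP solution: its number of
  -- 1-factors is the parity of the degree and its 2-factors make up half the degree.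
  toHWP : (D : Decomposition n T1 T2) → nMatchings D ≤ 1 → HWP n (fold D) T1 T2 (nFactors₁ D) (nFactors₂ D)
  toHWP {n} D k≤1 = record
    { countOK = sym (trans (cong (_/ 2) degree′) half)
    ; fs1 = factors₁ D ; len1 = refl ; type1 = types₁ D
    ; fs2 = factors₂ D ; len2 = refl ; type2 = types₂ D
    ; ones = matchings D ; lenOnes = sym (trans (cong (_% 2) degree′) parity)
    ; decomp = covers D }
    where
    a k : ℕ
    a = nFactors₁ D + nFactors₂ D
    k = nMatchings D
    k<2 : k < 2
    k<2 = s≤s k≤1
    degree′ : fold D * (n ∸ 1) ≡ k + a * 2
    degree′ = trans (sym (degree D)) (solve 2 (λ a k → con 2 :* a :+ k := k :+ a :* con 2) refl a k)
    no-carry : k % 2 + a * 2 % 2 < 2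
    no-carry = subst (_< 2) (sym (trans (cong₂ _+_ (m<n⇒m%n≡m k<2) (m*n%n≡0 a 2)) (+-identityʳ k))) k<2
    half : (k + a * 2) / 2 ≡ a
    half = trans (+-distrib-/ k (a * 2) no-carry) (cong₂ _+_ (m<n⇒m/n≡0 k<2) (m*n/n≡m a 2))
    parity : (k + a * 2) % 2 ≡ k
    parity = trans ([m+kn]%n≡m%n k a 2) (m<n⇒m%n≡m k<2)

  ∅ : Decomposition n T1 T2
  ∅ = record { fold = 0 ; factors₁ = [] ; factors₂ = [] ; matchings = [] ; types₁ = [] ; types₂ = []
             ; degree = refl ; covers = λ _ _ _ → refl }

  _⊕_ : Decomposition n T1 T2 → Decomposition n T1 T2 → Decomposition n T1 T2
  _⊕_ {n} D E = record
    { fold      = fold D + fold E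
    ; factors₁  = factors₁ D ++ factors₁ E
    ; factors₂  = factors₂ D ++ factors₂ E
    ; matchings = matchings D ++ matchings E
    ; types₁    = AllP.++⁺ (types₁ D) (types₁ E)
    ; types₂    = AllP.++⁺ (types₂ D) (types₂ E)
    ; degree    = begin
        2 * (length (factors₁ D ++ factors₁ E) + length (factors₂ D ++ factors₂ E)) + length (matchings D ++ matchings E)
          ≡⟨ cong₂ (λ a k → 2 * a + k) (cong₂ _+_ (length-++ (factors₁ D)) (length-++ (factors₂ D)))
                                       (length-++ (matchings D)) ⟩
        2 * ((nFactors₁ D + nFactors₁ E) + (nFactors₂ D + nFactors₂ E)) + (nMatchings D + nMatchings E)
          ≡⟨ solve 6 (λ a b c a′ b′ c′ → con 2 :* ((a :+ a′) :+ (b :+ b′)) :+ (c :+ c′)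
                                      := (con 2 :* (a :+ b) :+ c) :+ (con 2 :* (a′ :+ b′) :+ c′))
                     refl (nFactors₁ D) (nFactors₂ D) (nMatchings D) (nFactors₁ E) (nFactors₂ E) (nMatchings E) ⟩
        (2 * (nFactors₁ D + nFactors₂ D) + nMatchings D) + (2 * (nFactors₁ E + nFactors₂ E) + nMatchings E)
          ≡⟨ cong₂ _+_ (degree D) (degree E) ⟩
        fold D * (n ∸ 1) + fold E * (n ∸ 1)
          ≡⟨ *-distribʳ-+ (n ∸ 1) (fold D) (fold E) ⟨
        (fold D + fold E) * (n ∸ 1) ∎
    ; covers    = λ u v u≢v →
        trans (edgeMult-allEdges-++ u v (factors₁ D) (factors₁ E) (factors₂ D) (factors₂ E) (matchings D) (matchings E))
              (cong₂ _+_ (covers D u v u≢v) (covers E u v u≢v))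
    }
    where open ≡-Reasoning

  relabel : Relabelling n → Decomposition n T1 T2 → Decomposition n T1 T2
  relabel {n} σ D = record
    { fold      = fold D
    ; factors₁  = map twoFactor (factors₁ D)
    ; factors₂  = map twoFactor (factors₂ D)
    ; matchings = map oneFactor (matchings D)
    ; types₁    = AllP.map⁺ (All.map (λ {F} → twoFactor-type {F} T1) (types₁ D))
    ; types₂    = AllP.map⁺ (All.map (λ {F} → twoFactor-type {F} T2) (types₂ D))
    ; degree    = trans (cong₂ (λ a k → 2 * a + k)
                               (cong₂ _+_ (length-map twoFactor (factors₁ D)) (length-map twoFactor (factors₂ D)))
                               (length-map oneFactor (matchings D)))
                        (degree D)
    ; covers    = λ u v u≢v → begin
        edgeMult u v (allEdges (map twoFactor (factors₁ D)) (map twoFactor (factors₂ D)) (map oneFactor (matchings D)))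
          ≡⟨ cong (edgeMult u v) (allEdges-map (factors₁ D) (factors₂ D) (matchings D)) ⟩
        edgeMult u v (map (mapEdge to) (allEdges (factors₁ D) (factors₂ D) (matchings D)))
          ≡⟨ edgeMult-relabelled u v (allEdges (factors₁ D) (factors₂ D) (matchings D)) ⟩
        edgeMult (from u) (from v) (allEdges (factors₁ D) (factors₂ D) (matchings D))
          ≡⟨ covers D (from u) (from v) (from-distinct u≢v) ⟩
        fold D ∎ }
    where
    open Relabelling σ
    open ≡-Reasoning

  absorb : (D : Decomposition n T1 T2) → nMatchings D ≡ 2 →
           (F : TwoFactor n) → TwoFactor.HasType F T1 → TwoFactor.edges F ↭ edges₁ (matchings D) →
           Decomposition n T1 T2
  absorb {n} D two F F-type F-edges = record
    { fold      = fold D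
    ; factors₁  = F ∷ factors₁ D
    ; factors₂  = factors₂ D
    ; matchings = []
    ; types₁    = F-type ∷ types₁ D
    ; types₂    = types₂ D
    ; degree    = begin
        2 * (suc (nFactors₁ D) + nFactors₂ D) + 0
          ≡⟨ solve 2 (λ a b → con 2 :* ((con 1 :+ a) :+ b) :+ con 0 := con 2 :* (a :+ b) :+ con 2)
                     refl (nFactors₁ D) (nFactors₂ D) ⟩
        2 * (nFactors₁ D + nFactors₂ D) + 2
          ≡⟨ cong (2 * (nFactors₁ D + nFactors₂ D) +_) two ⟨
        2 * (nFactors₁ D + nFactors₂ D) + nMatchings D
          ≡⟨ degree D ⟩
        fold D * (n ∸ 1) ∎
    ; covers    = λ u v u≢v →
        trans (edgeMult-absorb u v F (factors₁ D) (factors₂ D) (matchings D) F-edges) (covers D u v u≢v)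
    }
    where open ≡-Reasoning

swapTypes : ∀ {T1 T2} → Decomposition n T1 T2 → Decomposition n T2 T1
swapTypes {n} D = record
  { fold      = fold D
  ; factors₁  = factors₂ D
  ; factors₂  = factors₁ D
  ; matchings = matchings D
  ; types₁    = types₂ D
  ; types₂    = types₁ D
  ; degree    = trans (cong (λ a → 2 * a + nMatchings D) (+-comm (nFactors₂ D) (nFactors₁ D))) (degree D)
  ; covers    = λ u v u≢v →
      trans (edgeMult-↭ u v (shifts (edges₂ (factors₂ D)) (edges₂ (factors₁ D)))) (covers D u v u≢v)
  }

rename : List (Fin n) → List (Fin n) → Fin n → Fin n
rename []       _        v = v
rename (k ∷ ks) []       v = v
rename (k ∷ ks) (w ∷ ws) v with k ≟F v
... | yes _ = w
... | no  _ = rename ks ws v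

rename-hit : (k : Fin n) (ks : List (Fin n)) (w : Fin n) (ws : List (Fin n)) → rename (k ∷ ks) (w ∷ ws) k ≡ w
rename-hit k ks w ws with k ≟F k
... | yes _  = refl
... | no k≢k = ⊥-elim (k≢k refl)

rename-miss : {k v : Fin n} (ks : List (Fin n)) (w : Fin n) (ws : List (Fin n)) →
              k ≢ v → rename (k ∷ ks) (w ∷ ws) v ≡ rename ks ws v
rename-miss {k = k} {v} ks w ws k≢v with k ≟F v
... | yes k≡v = ⊥-elim (k≢v k≡v)
... | no  _   = refl

rename-maps : (ks ws : List (Fin n)) → Unique ks → length ks ≡ length ws → map (rename ks ws) ks ≡ ws
rename-maps []       []       _             _   = refl
rename-maps (k ∷ ks) (w ∷ ws) (k∉ks ∷ uniq) len =
  cong₂ _∷_ (rename-hit k ks w ws)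
            (trans (map-cong-local (All.map (rename-miss ks w ws) k∉ks)) (rename-maps ks ws uniq (suc-injective len)))

rename-∈ : (ks ws : List (Fin n)) → length ks ≡ length ws → ∀ {v} → v ∈ ks → rename ks ws v ∈ ws
rename-∈ (k ∷ ks) (w ∷ ws) len (here refl) = here (rename-hit k ks w ws)
rename-∈ (k ∷ ks) (w ∷ ws) len {v} (there v∈ks) with k ≟F v
... | yes _ = here refl
... | no  _ = there (rename-∈ ks ws (suc-injective len) v∈ks)

rename-inverse : (ks ws : List (Fin n)) → Unique ks → Unique ws → length ks ≡ length ws →
                 ∀ {v} → v ∈ ks → rename ws ks (rename ks ws v) ≡ v
rename-inverse (k ∷ ks) (w ∷ ws) _ _ _ (here refl) =
  trans (cong (rename (w ∷ ws) (k ∷ ks)) (rename-hit k ks w ws)) (rename-hit w ws k ks)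
rename-inverse (k ∷ ks) (w ∷ ws) (k∉ks ∷ uks) (w∉ws ∷ uws) len {v} (there v∈ks) = begin
  rename (w ∷ ws) (k ∷ ks) (rename (k ∷ ks) (w ∷ ws) v)
    ≡⟨ cong (rename (w ∷ ws) (k ∷ ks)) (rename-miss ks w ws (All.lookup k∉ks v∈ks)) ⟩
  rename (w ∷ ws) (k ∷ ks) (rename ks ws v)
    ≡⟨ rename-miss ws k ks (All.lookup w∉ws (rename-∈ ks ws len′ v∈ks)) ⟩
  rename ws ks (rename ks ws v)
    ≡⟨ rename-inverse ks ws uks uws len′ v∈ks ⟩
  v ∎
  where
  open ≡-Reasoning
  len′ : length ks ≡ length ws
  len′ = suc-injective len

endpoints-map : ∀ (f : Fin n → Fin n) (ps qs : List (Fin n × Fin n)) →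
                map f (endpoints ps) ≡ endpoints qs → map (mapEdge f) ps ≡ qs
endpoints-map f []       []       _  = refl
endpoints-map f (p ∷ ps) (q ∷ qs) eq with ∷-injective eq
... | eq₁ , eq′ with ∷-injective eq′
... | eq₂ , eq″ = cong₂ _∷_ (cong₂ _,_ eq₁ eq₂) (endpoints-map f ps qs eq″)

matchingRelabelling : (P Q : OneFactor n) →
                      Σ (Relabelling n) λ σ → map (mapEdge (Relabelling.to σ)) (OneFactor.pairs P) ≡ OneFactor.pairs Q
matchingRelabelling {n} P Q = σ , endpoints-map (rename ks ws) (OneFactor.pairs P) (OneFactor.pairs Q) ks↦ws
  where
  ks ws : List (Fin n)
  ks = endpoints (OneFactor.pairs P)
  ws = endpoints (OneFactor.pairs Q)
  ks↭ : ks ↭ allFin n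
  ks↭ = OneFactor.spanning P
  ws↭ : ws ↭ allFin n
  ws↭ = OneFactor.spanning Q
  unique : ∀ {xs} → xs ↭ allFin n → Unique xs
  unique xs↭ = PermSetoid.Unique-resp-↭ (setoid (Fin n)) (↭⇒↭ₛ (↭-sym xs↭)) (allFin⁺ n)
  member : ∀ {xs} → xs ↭ allFin n → ∀ a → a ∈ xs
  member xs↭ a = ∈-resp-↭ (↭-sym xs↭) (∈-allFin a)
  len : length ks ≡ length ws
  len = trans (↭-length ks↭) (sym (↭-length ws↭))
  ks↦ws : map (rename ks ws) ks ≡ ws
  ks↦ws = rename-maps ks ws (unique ks↭) len
  σ : Relabelling n
  σ = record
    { to       = rename ks ws
    ; from     = rename ws ks
    ; from-to  = λ a → rename-inverse ks ws (unique ks↭) (unique ws↭) len (member ks↭ a)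
    ; to-from  = λ a → rename-inverse ws ks (unique ws↭) (unique ks↭) (sym len) (member ws↭ a)
    ; permutes = ↭-trans (map⁺ (rename ks ws) (↭-sym ks↭)) (↭-trans (↭-reflexive ks↦ws) ws↭)
    }

concatMap-↭ : ∀ {A B : Set} {f g : A → List B} → (∀ x → f x ↭ g x) → ∀ xs → concatMap f xs ↭ concatMap g xs
concatMap-↭ f↭g []       = ↭-refl
concatMap-↭ f↭g (x ∷ xs) = ++⁺ (f↭g x) (concatMap-↭ f↭g xs)

concatMap-++-↭ : ∀ {A B : Set} (f g : A → List B) xs →
                 concatMap (λ x → f x ++ g x) xs ↭ concatMap f xs ++ concatMap g xs
concatMap-++-↭ f g []       = ↭-refl
concatMap-++-↭ f g (x ∷ xs) =
  ↭-trans (++-assoc (f x) (g x) _)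
    (↭-trans (++⁺ˡ (f x) (↭-trans (++⁺ˡ (g x) (concatMap-++-↭ f g xs)) (shifts (g x) (concatMap f xs))))
      (↭-sym (++-assoc (f x) (concatMap f xs) _)))

chunks : ∀ {A : Set} → List ℕ → List A → List (List A)
chunks []       xs = []
chunks (c ∷ cs) xs = take c xs ∷ chunks cs (drop c xs)

chunks-rest : ∀ {A : Set} c cs (xs : List A) → c + sum cs ≡ length xs → sum cs ≡ length (drop c xs)
chunks-rest c cs xs eq = trans (sym (m+n∸m≡n c (sum cs))) (trans (cong (_∸ c) eq) (sym (length-drop c xs)))

concat-chunks : ∀ {A : Set} cs (xs : List A) → sum cs ≡ length xs → concat (chunks cs xs) ≡ xs
concat-chunks []       []       _  = refl
concat-chunks (c ∷ cs) xs       eq =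
  trans (cong (take c xs ++_) (concat-chunks cs (drop c xs) (chunks-rest c cs xs eq))) (take++drop≡id c xs)

lengths-chunks : ∀ {A : Set} cs (xs : List A) → sum cs ≡ length xs → map length (chunks cs xs) ≡ cs
lengths-chunks []       xs _  = refl
lengths-chunks (c ∷ cs) xs eq =
  cong₂ _∷_ (trans (length-take c xs) (m≤n⇒m⊓n≡m (subst (c ≤_) eq (m≤m+n c (sum cs)))))
            (lengths-chunks cs (drop c xs) (chunks-rest c cs xs eq))

length-endpoints : (ps : List (Fin n × Fin n)) → length (endpoints ps) ≡ 2 * length ps
length-endpoints []       = refl
length-endpoints (p ∷ ps) = trans (cong (2 +_) (length-endpoints ps)) (sym (*-suc 2 (length ps)))

endpoints-concat : (pss : List (List (Fin n × Fin n))) → endpoints (concat pss) ≡ concatMap endpoints pss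
endpoints-concat []         = refl
endpoints-concat (ps ∷ pss) = trans (concatMap-++ _ ps (concat pss)) (cong (endpoints ps ++_) (endpoints-concat pss))

double-half : ∀ t → Even t → 2 * (t / 2) ≡ t
double-half t even = begin
  2 * (t / 2)         ≡⟨ *-comm 2 (t / 2) ⟩
  t / 2 * 2           ≡⟨ cong (_+ t / 2 * 2) even ⟨
  t % 2 + t / 2 * 2   ≡⟨ m≡m%n+[m/n]*n t 2 ⟨
  t                   ∎
  where open ≡-Reasoning

double-sum-halves : ∀ T → All Even T → 2 * sum (map (_/ 2) T) ≡ sum T
double-sum-halves []      []            = refl
double-sum-halves (t ∷ T) (even ∷ evens) =
  trans (*-distribˡ-+ 2 (t / 2) _) (cong₂ _+_ (double-half t even) (double-sum-halves T evens))

-- For a chunk (a₁,b₁) … (a_k,b_k) of a matching, the cycle a₁ b₁ a₂ b₂ … a_k b_k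
-- consists of the chunk itself and the connecting edges b₁a₂, …, b_{k-1}a_k, b_k a₁.
connectFrom : Fin n → List (Fin n × Fin n) → List (Fin n × Fin n)
connectFrom z []                      = []
connectFrom z ((a , b) ∷ [])          = (b , z) ∷ []
connectFrom z ((a , b) ∷ (c , d) ∷ r) = (b , c) ∷ connectFrom z ((c , d) ∷ r)

connectors : List (Fin n × Fin n) → List (Fin n × Fin n)
connectors []            = []
connectors ((a , b) ∷ r) = connectFrom a ((a , b) ∷ r)

endpoints-connectFrom : (z a b : Fin n) (r : List (Fin n × Fin n)) →
                        endpoints (connectFrom z ((a , b) ∷ r)) ≡ b ∷ (endpoints r ++ z ∷ [])
endpoints-connectFrom z a b []            = refl
endpoints-connectFrom z a b ((c , d) ∷ r) = cong (λ w → b ∷ c ∷ w) (endpoints-connectFrom z c d r)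

endpoints-connectors : (c : List (Fin n × Fin n)) → endpoints (connectors c) ↭ endpoints c
endpoints-connectors []            = ↭-refl
endpoints-connectors ((a , b) ∷ r) =
  ↭-trans (↭-reflexive (endpoints-connectFrom a a b r)) (↭-trans (prep b (++-comm (endpoints r) (a ∷ []))) (swap b a ↭-refl))

closingPath-chunk : (z a b : Fin n) (r : List (Fin n × Fin n)) →
                    closingPath z (a ∷ b ∷ endpoints r) ↭ ((a , b) ∷ r) ++ connectFrom z ((a , b) ∷ r)
closingPath-chunk z a b []            = ↭-refl
closingPath-chunk z a b ((c , d) ∷ r) =
  prep (a , b) (↭-trans (prep (b , c) (closingPath-chunk z c d r))
                        (↭-sym (shift (b , c) ((c , d) ∷ r) (connectFrom z ((c , d) ∷ r)))))

cycEdges-chunk : (c : List (Fin n × Fin n)) → cycEdges (endpoints c) ↭ c ++ connectors c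
cycEdges-chunk []            = ↭-refl
cycEdges-chunk ((a , b) ∷ r) = ↭-trans (↭-reflexive (cycEdges≡closingPath a (b ∷ endpoints r))) (closingPath-chunk a a b r)

-- Through any perfect matching P runs a 2-factor of any bipartite type T: cut P
-- into consecutive pieces of t/2 edges (t ∈ T) and close each piece into a
-- cycle of length t.  The remaining cycle edges form a second perfect matching,
-- the partner of P, so the 2-factor is exactly the union of P and its partner.
module FactorThrough (P : OneFactor n) {T : List ℕ} (T-type : IsTwoFactorType n T) (T-bipartite : Bipartite T) where
  open OneFactor P using (pairs; spanning)

  pieces : List (List (Fin n × Fin n))
  pieces = chunks (map (_/ 2) T) pairs

  sizes : sum (map (_/ 2) T) ≡ length pairs
  sizes = *-cancelˡ-≡ _ _ 2 (begin
    2 * sum (map (_/ 2) T)   ≡⟨ double-sum-halves T T-bipartite ⟩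
    sum T                    ≡⟨ proj₂ T-type ⟩
    n                        ≡⟨ length-tabulate (λ a → a) ⟨
    length (allFin n)        ≡⟨ ↭-length spanning ⟨
    length (endpoints pairs) ≡⟨ length-endpoints pairs ⟩
    2 * length pairs         ∎)
    where open ≡-Reasoning

  concat-pieces : concat pieces ≡ pairs
  concat-pieces = concat-chunks (map (_/ 2) T) pairs sizes

  endpoints-pieces : concatMap endpoints pieces ↭ allFin n
  endpoints-pieces = ↭-trans (↭-reflexive (trans (sym (endpoints-concat pieces)) (cong endpoints concat-pieces))) spanning

  cycle-lengths : map length (map endpoints pieces) ≡ T
  cycle-lengths = begin
    map length (map endpoints pieces)  ≡⟨ map-∘ pieces ⟨
    map (length ∘ endpoints) pieces    ≡⟨ map-cong length-endpoints pieces ⟩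
    map ((2 *_) ∘ length) pieces       ≡⟨ map-∘ pieces ⟩
    map (2 *_) (map length pieces)     ≡⟨ cong (map (2 *_)) (lengths-chunks (map (_/ 2) T) pairs sizes) ⟩
    map (2 *_) (map (_/ 2) T)          ≡⟨ map-∘ T ⟨
    map (λ t → 2 * (t / 2)) T          ≡⟨ map-cong-local (All.map (λ {t} → double-half t) T-bipartite) ⟩
    map (λ t → t) T                    ≡⟨ map-id T ⟩
    T                                  ∎
    where open ≡-Reasoning

  factor : TwoFactor n
  factor = record
    { cycles   = map endpoints pieces
    ; cycLen   = AllP.map⁻ (subst (All (2 ≤_)) (sym cycle-lengths) (proj₁ T-type))
    ; spanning = endpoints-pieces
    }

  factor-type : TwoFactor.HasType factor T
  factor-type = ↭-reflexive cycle-lengths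

  partner : OneFactor n
  partner = record
    { pairs    = concatMap connectors pieces
    ; spanning = begin
        endpoints (concatMap connectors pieces)        ≡⟨ endpoints-concat (map connectors pieces) ⟩
        concatMap endpoints (map connectors pieces)    ≡⟨ concatMap-map endpoints connectors pieces ⟩
        concatMap (endpoints ∘ connectors) pieces      ↭⟨ concatMap-↭ endpoints-connectors pieces ⟩
        concatMap endpoints pieces                     ↭⟨ endpoints-pieces ⟩
        allFin n                                       ∎
    }
    where open PermutationReasoning

  factor-edges : TwoFactor.edges factor ↭ pairs ++ OneFactor.pairs partner
  factor-edges = begin
    concatMap cycEdges (map endpoints pieces)       ≡⟨ concatMap-map cycEdges endpoints pieces ⟩
    concatMap (cycEdges ∘ endpoints) pieces         ↭⟨ concatMap-↭ cycEdges-chunk pieces ⟩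
    concatMap (λ c → c ++ connectors c) pieces      ↭⟨ concatMap-++-↭ (λ c → c) connectors pieces ⟩
    concatMap (λ c → c) pieces ++ partner-edges     ≡⟨ cong (λ ps → concat ps ++ partner-edges) (map-id pieces) ⟩
    concat pieces ++ partner-edges                  ≡⟨ cong (_++ partner-edges) concat-pieces ⟩
    pairs ++ partner-edges                          ∎
    where
    open PermutationReasoning
    partner-edges : List (Fin n × Fin n)
    partner-edges = concatMap connectors pieces

-- A decomposition with exactly one 1-factor: the shape of an HWP solution
-- for λK_n when λ(n ∸ 1) is odd.
record OddDecomposition (n : ℕ) (T1 T2 : List ℕ) : Set where
  field
    decomposition : Decomposition n T1 T2
    matching      : OneFactor n
    only-matching : matchings decomposition ≡ matching ∷ []

open OddDecomposition

swapOdd : ∀ {T1 T2} → OddDecomposition n T1 T2 → OddDecomposition n T2 T1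
swapOdd s = record { decomposition = swapTypes (decomposition s) ; matching = matching s ; only-matching = only-matching s }

module _ {T1 T2 : List ℕ} where

  -- Two odd decompositions, of λK_n and λ'K_n, merge into a decomposition of
  -- (λ + λ')K_n without 1-factors and with one extra T1-factor, provided T1 is
  -- bipartite: relabel the second so that its 1-factor becomes the partner of
  -- the first one's; together these two 1-factors form a 2-factor of type T1.
  merge : IsTwoFactorType n T1 → Bipartite T1 →
          OddDecomposition n T1 T2 → OddDecomposition n T1 T2 → Decomposition n T1 T2
  merge T1-type T1-bipartite s t = absorb (D ⊕ relabel σ E) two-matchings factor factor-type edges-match
    where
    open FactorThrough (matching s) T1-type T1-bipartite
    D E : Decomposition _ T1 T2
    D = decomposition s
    E = decomposition t
    σ : Relabelling _
    σ = proj₁ (matchingRelabelling (matching t) partner)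
    onto-partner : map (mapEdge (Relabelling.to σ)) (OneFactor.pairs (matching t)) ≡ OneFactor.pairs partner
    onto-partner = proj₂ (matchingRelabelling (matching t) partner)
    merged-matchings : matchings (D ⊕ relabel σ E) ≡ matching s ∷ Relabelling.oneFactor σ (matching t) ∷ []
    merged-matchings = cong₂ (λ ms ms′ → ms ++ map (Relabelling.oneFactor σ) ms′) (only-matching s) (only-matching t)
    two-matchings : nMatchings (D ⊕ relabel σ E) ≡ 2
    two-matchings = cong length merged-matchings
    edges-match : TwoFactor.edges factor ↭ edges₁ (matchings (D ⊕ relabel σ E))
    edges-match = ↭-trans factor-edges (↭-reflexive (sym (trans (cong edges₁ merged-matchings)
                    (cong (OneFactor.pairs (matching s) ++_) (trans (++-identityʳ _) onto-partner)))))

  merge-factors₁ : (T1-type : IsTwoFactorType n T1) (T1-bipartite : Bipartite T1) (s t : OddDecomposition n T1 T2) →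
                   nFactors₁ (merge T1-type T1-bipartite s t)
                   ≡ suc (nFactors₁ (decomposition s) + nFactors₁ (decomposition t))
  merge-factors₁ T1-type T1-bipartite s t =
    cong suc (trans (length-++ (factors₁ (decomposition s)))
                    (cong (nFactors₁ (decomposition s) +_) (length-map _ (factors₁ (decomposition t)))))

  merge-factors₂ : (T1-type : IsTwoFactorType n T1) (T1-bipartite : Bipartite T1) (s t : OddDecomposition n T1 T2) →
                   nFactors₂ (merge T1-type T1-bipartite s t)
                   ≡ nFactors₂ (decomposition s) + nFactors₂ (decomposition t)
  merge-factors₂ T1-type T1-bipartite s t =
    trans (length-++ (factors₂ (decomposition s)))
          (cong (nFactors₂ (decomposition s) +_) (length-map _ (factors₂ (decomposition t))))

merge₂ : ∀ {T1 T2} → IsTwoFactorType n T2 → Bipartite T2 →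
         OddDecomposition n T1 T2 → OddDecomposition n T1 T2 → Decomposition n T1 T2
merge₂ T2-type T2-bipartite s t = swapTypes (merge T2-type T2-bipartite (swapOdd s) (swapOdd t))

total : ∀ {A : Set} → (A → ℕ) → List A → ℕ
total f xs = sum (map f xs)

total-++ : ∀ {A : Set} (f : A → ℕ) xs ys → total f (xs ++ ys) ≡ total f xs + total f ys
total-++ f xs ys = trans (cong sum (map-++ f xs ys)) (sum-++ (map f xs) (map f ys))

total-↭ : ∀ {A : Set} (f : A → ℕ) {xs ys} → xs ↭ ys → total f xs ≡ total f ys
total-↭ f xs↭ys = sum-↭ (map⁺ f xs↭ys)

module _ {T1 T2 : List ℕ} where

  -- R realises the list Ds with a extra T1-factors and g extra T2-factors if R
  -- decomposes the sum of the multigraphs of Ds, using all their 2-factors plus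
  -- a + g new ones, each new 2-factor replacing two of their 1-factors.
  record Realises (Ds : List (Decomposition n T1 T2)) (a g : ℕ) (R : Decomposition n T1 T2) : Set where
    field
      fold-total       : fold R ≡ total fold Ds
      factors₁-total   : nFactors₁ R ≡ total nFactors₁ Ds + a
      factors₂-total   : nFactors₂ R ≡ total nFactors₂ Ds + g
      matchings-total  : nMatchings R + 2 * (a + g) ≡ total nMatchings Ds

  open Realises

  ⊕-realises : {Ds Es : List (Decomposition n T1 T2)} {a a′ g g′ : ℕ} {R S : Decomposition n T1 T2} →
               Realises Ds a g R → Realises Es a′ g′ S →
               Realises (Ds ++ Es) (a + a′) (g + g′) (R ⊕ S)
  ⊕-realises {n} {Ds} {Es} {a} {a′} {g} {g′} {R} {S} r s = record
    { fold-total      = trans (cong₂ _+_ (fold-total r) (fold-total s)) (sym (total-++ fold Ds Es))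
    ; factors₁-total  = counts nFactors₁ a a′ (length-++ (factors₁ R)) (factors₁-total r) (factors₁-total s)
    ; factors₂-total  = counts nFactors₂ g g′ (length-++ (factors₂ R)) (factors₂-total r) (factors₂-total s)
    ; matchings-total = begin
        nMatchings (R ⊕ S) + 2 * ((a + a′) + (g + g′))
          ≡⟨ cong (_+ 2 * ((a + a′) + (g + g′))) (length-++ (matchings R)) ⟩
        (nMatchings R + nMatchings S) + 2 * ((a + a′) + (g + g′))
          ≡⟨ solve 6 (λ k k′ a a′ g g′ → (k :+ k′) :+ con 2 :* ((a :+ a′) :+ (g :+ g′))
                                          := (k :+ con 2 :* (a :+ g)) :+ (k′ :+ con 2 :* (a′ :+ g′)))
                     refl (nMatchings R) (nMatchings S) a a′ g g′ ⟩
        (nMatchings R + 2 * (a + g)) + (nMatchings S + 2 * (a′ + g′))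
          ≡⟨ cong₂ _+_ (matchings-total r) (matchings-total s) ⟩
        total nMatchings Ds + total nMatchings Es
          ≡⟨ total-++ nMatchings Ds Es ⟨
        total nMatchings (Ds ++ Es) ∎ }
    where
    open ≡-Reasoning
    counts : ∀ (f : Decomposition n T1 T2 → ℕ) e e′ → f (R ⊕ S) ≡ f R + f S →
             f R ≡ total f Ds + e → f S ≡ total f Es + e′ → f (R ⊕ S) ≡ total f (Ds ++ Es) + (e + e′)
    counts f e e′ split fR fS = begin
      f (R ⊕ S)                                ≡⟨ split ⟩
      f R + f S                                ≡⟨ cong₂ _+_ fR fS ⟩
      (total f Ds + e) + (total f Es + e′)     ≡⟨ solve 4 (λ x e y e′ → (x :+ e) :+ (y :+ e′) := (x :+ y) :+ (e :+ e′))
                                                          refl (total f Ds) e (total f Es) e′ ⟩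
      (total f Ds + total f Es) + (e + e′)     ≡⟨ cong (_+ (e + e′)) (total-++ f Ds Es) ⟨
      total f (Ds ++ Es) + (e + e′)            ∎

  _⊕ᵣ_ : {Ds Es : List (Decomposition n T1 T2)} {a a′ g g′ : ℕ} →
         Σ (Decomposition n T1 T2) (Realises Ds a g) → Σ (Decomposition n T1 T2) (Realises Es a′ g′) →
         Σ (Decomposition n T1 T2) (Realises (Ds ++ Es) (a + a′) (g + g′))
  (R , r) ⊕ᵣ (S , s) = R ⊕ S , ⊕-realises {R = R} {S = S} r s

  realises-↭ : {Ds Es : List (Decomposition n T1 T2)} {a g : ℕ} {R : Decomposition n T1 T2} →
               Ds ↭ Es → Realises Ds a g R → Realises Es a g R
  realises-↭ {a = a} {g} Ds↭Es r = record
    { fold-total      = trans (fold-total r) (total-↭ fold Ds↭Es)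
    ; factors₁-total  = trans (factors₁-total r) (cong (_+ a) (total-↭ nFactors₁ Ds↭Es))
    ; factors₂-total  = trans (factors₂-total r) (cong (_+ g) (total-↭ nFactors₂ Ds↭Es))
    ; matchings-total = trans (matchings-total r) (total-↭ nMatchings Ds↭Es)
    }

  ⋃ : List (Decomposition n T1 T2) → Decomposition n T1 T2
  ⋃ []       = ∅
  ⋃ (D ∷ Ds) = D ⊕ ⋃ Ds

  ⋃-realises : (Ds : List (Decomposition n T1 T2)) → Realises Ds 0 0 (⋃ Ds)
  ⋃-realises []       = record { fold-total = refl ; factors₁-total = refl ; factors₂-total = refl ; matchings-total = refl }
  ⋃-realises (D ∷ Ds) = ⊕-realises {Ds = D ∷ []} itself (⋃-realises Ds)
    where
    itself : Realises (D ∷ []) 0 0 D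
    itself = record { fold-total      = sym (+-identityʳ (fold D))
                    ; factors₁-total  = sym (trans (+-identityʳ _) (+-identityʳ _))
                    ; factors₂-total  = sym (trans (+-identityʳ _) (+-identityʳ _))
                    ; matchings-total = refl }

  pair-realises : (s t : OddDecomposition n T1 T2) (a g : ℕ) → a + g ≡ 1 → (R : Decomposition n T1 T2) →
                  fold R ≡ fold (decomposition s) + fold (decomposition t) →
                  nFactors₁ R ≡ nFactors₁ (decomposition s) + nFactors₁ (decomposition t) + a →
                  nFactors₂ R ≡ nFactors₂ (decomposition s) + nFactors₂ (decomposition t) + g →
                  nMatchings R ≡ 0 → Realises (decomposition s ∷ decomposition t ∷ []) a g R
  pair-realises s t a g one R fold≡ n₁≡ n₂≡ none = record
    { fold-total      = trans fold≡ (cong (fold D +_) (sym (+-identityʳ (fold E))))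
    ; factors₁-total  = trans n₁≡ (cong (λ m → nFactors₁ D + m + a) (sym (+-identityʳ (nFactors₁ E))))
    ; factors₂-total  = trans n₂≡ (cong (λ m → nFactors₂ D + m + g) (sym (+-identityʳ (nFactors₂ E))))
    ; matchings-total = begin
        nMatchings R + 2 * (a + g)        ≡⟨ cong₂ (λ k m → k + 2 * m) none one ⟩
        2                                 ≡⟨ cong₂ (λ k k′ → k + (k′ + 0)) (cong length (only-matching s))
                                                                         (cong length (only-matching t)) ⟨
        nMatchings D + (nMatchings E + 0) ∎ }
    where
    open ≡-Reasoning
    D E : Decomposition _ T1 T2
    D = decomposition s
    E = decomposition t

  merge-realises : (T1-type : IsTwoFactorType n T1) (T1-bipartite : Bipartite T1) (s t : OddDecomposition n T1 T2) →
                   Realises (decomposition s ∷ decomposition t ∷ []) 1 0 (merge T1-type T1-bipartite s t)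
  merge-realises T1-type T1-bipartite s t =
    pair-realises s t 1 0 refl (merge T1-type T1-bipartite s t) refl
      (trans (merge-factors₁ T1-type T1-bipartite s t) (+-comm 1 _))
      (trans (merge-factors₂ T1-type T1-bipartite s t) (sym (+-identityʳ _)))
      refl

  merge₂-realises : (T2-type : IsTwoFactorType n T2) (T2-bipartite : Bipartite T2) (s t : OddDecomposition n T1 T2) →
                    Realises (decomposition s ∷ decomposition t ∷ []) 0 1 (merge₂ T2-type T2-bipartite s t)
  merge₂-realises T2-type T2-bipartite s t =
    pair-realises s t 0 1 refl (merge₂ T2-type T2-bipartite s t) refl
      (trans (merge-factors₂ T2-type T2-bipartite (swapOdd s) (swapOdd t)) (sym (+-identityʳ _)))
      (trans (merge-factors₁ T2-type T2-bipartite (swapOdd s) (swapOdd t)) (+-comm 1 _))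
      refl

  total-matchings-odd : (Os : List (OddDecomposition n T1 T2)) → total nMatchings (map decomposition Os) ≡ length Os
  total-matchings-odd []       = refl
  total-matchings-odd (s ∷ Os) = cong₂ _+_ (cong length (only-matching s)) (total-matchings-odd Os)

  record Separation (Ds : List (Decomposition n T1 T2)) : Set where
    field
      evens           : List (Decomposition n T1 T2)
      odds            : List (OddDecomposition n T1 T2)
      evens-unmatched : total nMatchings evens ≡ 0
      rearranged      : Ds ↭ evens ++ map decomposition odds

  separate : (Ds : List (Decomposition n T1 T2)) → All (λ D → nMatchings D ≤ 1) Ds → Separation Ds
  separate []       []            = record { evens = [] ; odds = [] ; evens-unmatched = refl ; rearranged = ↭-refl }
  separate (D ∷ Ds) (D≤1 ∷ Ds≤1) with matchings D in only | separate Ds Ds≤1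
  ... | [] | S = record
    { evens           = D ∷ evens
    ; odds            = odds
    ; evens-unmatched = trans (cong (λ ms → length ms + total nMatchings evens) only) evens-unmatched
    ; rearranged      = prep D rearranged }
    where open Separation S
  ... | O ∷ [] | S = record
    { evens           = evens
    ; odds            = record { decomposition = D ; matching = O ; only-matching = only } ∷ odds
    ; evens-unmatched = evens-unmatched
    ; rearranged      = ↭-trans (prep D rearranged) (↭-sym (shift D evens (map decomposition odds))) }
    where open Separation S
  separate (D ∷ Ds) (s≤s () ∷ _) | _ ∷ _ ∷ _ | _

two-fewer : ∀ m k → 2 * suc m ≤ suc (suc k) → 2 * m ≤ k
two-fewer m k le with subst (_≤ suc (suc k)) (*-suc 2 m) le
... | s≤s (s≤s le′) = le′

too-few : ∀ m → ¬ (2 * suc m ≤ 1)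
too-few m le with subst (_≤ 1) (*-suc 2 m) le
... | s≤s ()

module _ {T1 T2 : List ℕ} (T1-type : IsTwoFactorType n T1) (T2-type : IsTwoFactorType n T2) where

  pairUp : (Os : List (OddDecomposition n T1 T2)) (a g : ℕ) → (a ≡ 0 ⊎ Bipartite T1) → (g ≡ 0 ⊎ Bipartite T2) →
           2 * (a + g) ≤ length Os → Σ (Decomposition n T1 T2) (Realises (map decomposition Os) a g)
  pairUp Os           zero    zero    _             _             _  =
    ⋃ (map decomposition Os) , ⋃-realises (map decomposition Os)
  pairUp Os           (suc a) g       (inj₁ ())     _             _
  pairUp Os           zero    (suc g) _             (inj₁ ())     _
  pairUp (s ∷ t ∷ Os) (suc a) g       (inj₂ T1-bip) T2-ok         le =
    (merge T1-type T1-bip s t , merge-realises T1-type T1-bip s t)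
      ⊕ᵣ pairUp Os a g (inj₂ T1-bip) T2-ok (two-fewer (a + g) (length Os) le)
  pairUp (s ∷ t ∷ Os) zero    (suc g) T1-ok         (inj₂ T2-bip) le =
    (merge₂ T2-type T2-bip s t , merge₂-realises T2-type T2-bip s t)
      ⊕ᵣ pairUp Os zero g T1-ok (inj₂ T2-bip) (two-fewer g (length Os) le)
  pairUp []           (suc a) g       (inj₂ _)      _             le = ⊥-elim (too-few (a + g) (≤-trans le z≤n))
  pairUp (_ ∷ [])     (suc a) g       (inj₂ _)      _             le = ⊥-elim (too-few (a + g) le)
  pairUp []           zero    (suc g) _             (inj₂ _)      le = ⊥-elim (too-few g (≤-trans le z≤n))
  pairUp (_ ∷ [])     zero    (suc g) _             (inj₂ _)      le = ⊥-elim (too-few g le)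

  combine : (Ds : List (Decomposition n T1 T2)) → All (λ D → nMatchings D ≤ 1) Ds → (a g : ℕ) →
            (a ≡ 0 ⊎ Bipartite T1) → (g ≡ 0 ⊎ Bipartite T2) → 2 * (a + g) ≤ total nMatchings Ds →
            Σ (Decomposition n T1 T2) (Realises Ds a g)
  combine Ds Ds≤1 a g T1-ok T2-ok enough =
    map₂ (realises-↭ (↭-sym rearranged)) ((⋃ evens , ⋃-realises evens) ⊕ᵣ paired)
    where
    open Separation (separate Ds Ds≤1)
    odd-count : total nMatchings Ds ≡ length odds
    odd-count = begin
      total nMatchings Ds
        ≡⟨ total-↭ nMatchings rearranged ⟩
      total nMatchings (evens ++ map decomposition odds)
        ≡⟨ total-++ nMatchings evens _ ⟩
      total nMatchings evens + total nMatchings (map decomposition odds)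
        ≡⟨ cong₂ _+_ evens-unmatched (total-matchings-odd odds) ⟩
      length odds ∎
      where open ≡-Reasoning
    paired : Σ (Decomposition _ T1 T2) (Realises (map decomposition odds) a g)
    paired = pairUp odds a g T1-ok T2-ok (subst (2 * (a + g) ≤_) odd-count enough)

copies : ∀ {I A : Set} → (I → ℕ) → (I → A) → List I → List A
copies w d is = concatMap (λ i → replicate (w i) (d i)) is

total-copies : ∀ {I A : Set} (f : A → ℕ) (w : I → ℕ) (d : I → A) is →
               total f (copies w d is) ≡ sum (map (λ i → w i * f (d i)) is)
total-copies f w d []       = refl
total-copies f w d (i ∷ is) =
  trans (total-++ f (replicate (w i) (d i)) (copies w d is)) (cong₂ _+_ (total-replicate (w i)) (total-copies f w d is))
  where
  total-replicate : ∀ k → total f (replicate k (d i)) ≡ k * f (d i)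
  total-replicate zero    = refl
  total-replicate (suc k) = cong (f (d i) +_) (total-replicate k)

All-copies : ∀ {I A : Set} {P : A → Set} (w : I → ℕ) (d : I → A) → (∀ i → P (d i)) → ∀ is → All P (copies w d is)
All-copies w d P-d is = AllP.concat⁺ (AllP.map⁺ (All.universal (λ i → AllP.replicate⁺ (w i) (P-d i)) is))

odd-indicator : ∀ m k → (if does ((m % 2) ≟ 1) then k else 0) ≡ k * (m % 2)
odd-indicator m k with m % 2 | m%n<n m 2
... | 0           | _              = sym (*-zeroʳ k)
... | 1           | _              = sym (*-identityʳ k)
... | suc (suc _) | s≤s (s≤s ())

HWP-cong : ∀ {T1 T2 λ₁ λ₂ a₁ a₂ g₁ g₂} → λ₁ ≡ λ₂ → a₁ ≡ a₂ → g₁ ≡ g₂ →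
           HWP n λ₁ T1 T2 a₁ g₁ → HWP n λ₂ T1 T2 a₂ g₂
HWP-cong refl refl refl H = H

combinedSolution : {ℓ : ℕ} {T1 T2 : List ℕ} → IsTwoFactorType n T1 → IsTwoFactorType n T2 →
                   (μ α γ : Fin ℓ → ℕ) → (∀ i → HWP n (μ i) T1 T2 (α i) (γ i)) →
                   (λ' : ℕ) (x : Fin ℓ → ℕ) → Σ[ (λ i → x i * μ i) ] ≡ λ' →
                   (a g r : ℕ) → (a ≡ 0 ⊎ Bipartite T1) → (g ≡ 0 ⊎ Bipartite T2) →
                   r ≤ 1 → r + 2 * (a + g) ≡ betaSum n μ x →
                   HWP n λ' T1 T2 (Σ[ (λ i → x i * α i) ] + a) (Σ[ (λ i → x i * γ i) ] + g)
combinedSolution {n} {ℓ} {T1} {T2} T1-type T2-type μ α γ solutions λ' x Σxμ≡λ a g r T1-ok T2-ok r≤1 r+2[a+g]≡β =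
  HWP-cong (trans (fold-total real) (trans (count {f = fold} (λ _ → refl)) Σxμ≡λ))
           (trans (factors₁-total real) (cong (_+ a) (count (λ i → HWP.len1 (solutions i)))))
           (trans (factors₂-total real) (cong (_+ g) (count (λ i → HWP.len2 (solutions i)))))
           (toHWP R (subst (_≤ 1) (sym leftover) r≤1))
  where
  open Realises
  Ds : List (Decomposition n T1 T2)
  Ds = copies x (λ i → fromHWP (solutions i)) (allFin ℓ)
  count : ∀ {f : Decomposition n _ _ → ℕ} {c : Fin ℓ → ℕ} → (∀ i → f (fromHWP (solutions i)) ≡ c i) →
          total f Ds ≡ Σ[ (λ i → x i * c i) ]
  count {f} f≡c = trans (total-copies f x (λ i → fromHWP (solutions i)) (allFin ℓ))
                        (cong sum (map-cong (λ i → cong (x i *_) (f≡c i)) (allFin ℓ)))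
  total-matchings : total nMatchings Ds ≡ betaSum n μ x
  total-matchings = trans (count (λ i → HWP.lenOnes (solutions i)))
                          (sym (cong sum (map-cong (λ i → odd-indicator (μ i * (n ∸ 1)) (x i)) (allFin ℓ))))
  at-most-one : All (λ D → nMatchings D ≤ 1) Ds
  at-most-one = All-copies x _ (λ i → subst (_≤ 1) (sym (HWP.lenOnes (solutions i))) (≤-pred (m%n<n (μ i * (n ∸ 1)) 2)))
                           (allFin ℓ)
  enough : 2 * (a + g) ≤ total nMatchings Ds
  enough = subst (2 * (a + g) ≤_) (trans r+2[a+g]≡β (sym total-matchings)) (m≤n+m (2 * (a + g)) r)
  combined : Σ (Decomposition n T1 T2) (Realises Ds a g)
  combined = combine T1-type T2-type Ds at-most-one a g T1-ok T2-ok enough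
  R : Decomposition n T1 T2
  R = proj₁ combined
  real : Realises Ds a g R
  real = proj₂ combined
  leftover : nMatchings R ≡ r
  leftover = +-cancelʳ-≡ (2 * (a + g)) (nMatchings R) r (trans (matchings-total real) (trans total-matchings (sym r+2[a+g]≡β)))

-- Theorem 7.1.  (i) is the construction with no extra factors; for (ii), half
-- of β is spent on extra factors and the parity of β on the remaining 1-factor.
theorem7p1 : (n ℓ : ℕ) → 1 ≤ n → 1 ≤ ℓ → (T1 T2 : List ℕ) →
    IsTwoFactorType n T1 → IsTwoFactorType n T2 →
    (μ α γ : Fin ℓ → ℕ) → (∀ i → 1 ≤ μ i) →
    (∀ i → HWP n (μ i) T1 T2 (α i) (γ i)) →
    (λ' : ℕ) → 1 ≤ λ' → (x : Fin ℓ → ℕ) → Σ[ (λ i → x i * μ i) ] ≡ λ' →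
    (betaSum n μ x ≤ 1 →
       HWP n λ' T1 T2 Σ[ (λ i → x i * α i) ] Σ[ (λ i → x i * γ i) ])
    × (Bipartite T1 → (ᾱ γ̄ : ℕ) → ᾱ + γ̄ ≡ betaSum n μ x / 2 →
       (¬ Bipartite T2 → γ̄ ≡ 0) →
       HWP n λ' T1 T2 (Σ[ (λ i → x i * α i) ] + ᾱ) (Σ[ (λ i → x i * γ i) ] + γ̄))
theorem7p1 n ℓ _ _ T1 T2 T1-type T2-type μ α γ _ solutions λ' _ x Σxμ≡λ = part-i , part-ii
  where
  β : ℕ
  β = betaSum n μ x
  solution : (a g r : ℕ) → (a ≡ 0 ⊎ Bipartite T1) → (g ≡ 0 ⊎ Bipartite T2) → r ≤ 1 → r + 2 * (a + g) ≡ β →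
             HWP n λ' T1 T2 (Σ[ (λ i → x i * α i) ] + a) (Σ[ (λ i → x i * γ i) ] + g)
  solution = combinedSolution T1-type T2-type μ α γ solutions λ' x Σxμ≡λ

  part-i : β ≤ 1 → HWP n λ' T1 T2 Σ[ (λ i → x i * α i) ] Σ[ (λ i → x i * γ i) ]
  part-i β≤1 =
    HWP-cong refl (+-identityʳ _) (+-identityʳ _) (solution 0 0 β (inj₁ refl) (inj₁ refl) β≤1 (+-identityʳ β))

  part-ii : Bipartite T1 → (ᾱ γ̄ : ℕ) → ᾱ + γ̄ ≡ β / 2 → (¬ Bipartite T2 → γ̄ ≡ 0) →
            HWP n λ' T1 T2 (Σ[ (λ i → x i * α i) ] + ᾱ) (Σ[ (λ i → x i * γ i) ] + γ̄)
  part-ii T1-bipartite ᾱ γ̄ ᾱ+γ̄≡β/2 γ̄-ok =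
    solution ᾱ γ̄ (β % 2) (inj₂ T1-bipartite) T2-ok (≤-pred (m%n<n β 2)) parity+halves
    where
    T2-ok : γ̄ ≡ 0 ⊎ Bipartite T2
    T2-ok with all? (λ t → t % 2 ≟ 0) T2
    ... | yes T2-bipartite = inj₂ T2-bipartite
    ... | no  ¬T2-bipartite = inj₁ (γ̄-ok ¬T2-bipartite)
    parity+halves : β % 2 + 2 * (ᾱ + γ̄) ≡ β
    parity+halves = trans (cong (λ h → β % 2 + 2 * h) ᾱ+γ̄≡β/2)
                          (trans (cong (β % 2 +_) (*-comm 2 (β / 2))) (sym (m≡m%n+[m/n]*n β 2)))
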